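{- (1) If $\Gamma\vdash M\Uparrow A$ in the simply-typed $\lambda$-calculus over $\Sigma$, then $\Gamma^+;\cdot;\cdot\vdash M^-\Uparrow A^-$ in the strict $\lambda$-calculus over $\Sigma^+$. (2) If $\Gamma\vdash M\downarrow A$, then $\Gamma^+;\cdot;\cdot\vdash M^+\downarrow A^+$.
   Context: Simply-typed $\lambda$-calculus: types $A::=a\mid A_1\to A_2$, terms $c\mid x\mid\lambda x{:}A.M\mid MN$, plus existential variables $E_A$. Canonical/atomic judgments: $c{:}A\in\Sigma$ gives $\Gamma\vdash c\downarrow A$; $x{:}A\in\Gamma$ gives $\Gamma\vdash x\downarrow A$; $\Gamma\vdash M\downarrow a$ gives $\Gamma\vdash M\Uparrow a$ ($a$ atomic); $(\Gamma,x{:}A)\vdash M\Uparrow B$ gives $\Gamma\vdash\lambda x{:}A.M\Uparrow A\to B$; $\Gamma\vdash M\downarrow A\to B$ and $\Gamma\vdash N\Uparrow A$ give $\Gamma\vdash MN\downarrow B$; and $\Gamma\vdash E_A\,x_1\dots x_n\Uparrow a$ whenever $A=A_1\to\cdots\to A_n\to a$ and $x_1,\dots,x_n$ are distinct with $x_i{:}A_i\in\Gamma$. Strict $\lambda$-calculus: labels $k\in\{1,0,u\}$, types $A::=a\mid A_1\to^kA_2$, terms $c\mid x\mid\lambda x^k{:}A.M\mid M_1M_2^k$. Canonical/atomic judgments $\Gamma;\Omega;\Delta\vdash M\Uparrow A$ / $\downarrow A$ ($\Gamma$ unrestricted, $\Omega$ irrelevant, $\Delta$ strict, disjoint; commas are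 disjoint unions): $c{:}A\in\Sigma$ gives $\Gamma;\Omega;\cdot\vdash c\downarrow A$; $(\Gamma,x{:}A);\Omega;\cdot\vdash x\downarrow A$; $\Gamma;\Omega;x{:}A\vdash x\downarrow A$; $M\downarrow a$ gives $M\Uparrow a$; from $(\Gamma,x{:}A);\Omega;\Delta\vdash M\Uparrow B$ infer $\Gamma;\Omega;\Delta\vdash\lambda x^u{:}A.M\Uparrow A\to^uB$, and similarly $\lambda x^0$ (adding $x$ to $\Omega$, type $A\to^0B$) and $\lambda x^1$ (adding $x$ to $\Delta$, type $A\to^1B$); from $\Gamma;\Omega;\Delta\vdash M\downarrow A\to^uB$ and $(\Gamma,\Delta);\Omega;\cdot\vdash N\Uparrow A$ infer $\Gamma;\Omega;\Delta\vdash MN^u\downarrow B$; from $\Gamma;\Omega;\Delta\vdash M\downarrow A\to^0B$ and $(\Gamma,\Omega,\Delta);\cdot;\cdot\vdash N\Uparrow A$ infer $\Gamma;\Omega;\Delta\vdash MN^0\downarrow B$; from $(\Gamma,\Delta_N);\Omega;\Delta_M\vdash M\downarrow A\to^1B$ and $(\Gamma,\Delta_M);\Omega;\Delta_N\vdash N\Uparrow A$ infer $\Gamma;\Omega;(\Delta_M,\Delta_N)\vdash MN^1\downarrow B$; and, for existential variables, $\Gamma;\cdot;\cdot\vdash F_B\,x_1^u\dots x_n^u\Uparrow a$ whenever $B=B_1\to^u\cdots\to^uB_n\to^ua$ and $x_1,\dots,x_n$ are distinct with $x_i{:}B_i\in\Gamma$. Translation: $(A\to B)^+=A^-\to^1B^+$,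 $(A\to B)^-=A^+\to^uB^-$, $a^+=a^-=a$. On terms: $(\lambda x{:}A.M)^-=\lambda x^u{:}A^+.M^-$; $(E_A\,x_1\dots x_n)^-=F_{A^- }\,x_1^u\dots x_n^u$ (one fresh $F_{A^- }$ per $E_A$); $M^-=M^+$ for other $M$ of atomic type; $x^+=x$, $c^+=c$, $(MN)^+=M^+\,(N^-)^1$. On contexts/signatures: $(\cdot)^+=\cdot$, $(\Gamma,x{:}A)^+=\Gamma^+,x{:}A^+$, $(\Sigma,a{:}\mathrm{type})^+=\Sigma^+,a{:}\mathrm{type}$, $(\Sigma,c{:}A)^+=\Sigma^+,c{:}A^+$. -}

module Defs where

open import Data.Nat using (ℕ)
open import Data.Product using (_×_; _,_; proj₁)
open import Data.List using (List; []; _∷_; _++_; map)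
open import Data.List.Membership.Propositional using (_∈_; _∉_)
open import Data.List.Relation.Unary.Unique.Propositional using (Unique)
open import Data.List.Relation.Ternary.Interleaving.Propositional using (Interleaving)

infixr 7 _⇒_
data Ty : Set where
  base : ℕ → Ty
  _⇒_  : Ty → Ty → Ty

-- terms: constants, variables, λx:A.M, application M N, and existential
-- variables applied to variables:  evar i A xs  is  E_A x₁ … xₙ
-- (i distinguishes different existential variables of the same type)
data Tm : Set where
  con  : ℕ → Tm
  var  : ℕ → Tm
  lam  : ℕ → Ty → Tm → Tm
  app  : Tm → Tm → Tm
  evar : ℕ → Ty → List ℕ → Tm

data Decl : Set where
  tydecl : ℕ → Decl
  cdecl  : ℕ → Ty → Decl

Sig : Set
Sig = List Decl

Ctx : Set
Ctx = List (ℕ × Ty)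

dom : ∀ {T : Set} → List (ℕ × T) → List ℕ
dom = map proj₁

data EvArgs (Γ : Ctx) : List ℕ → Ty → ℕ → Set where
  done : ∀ {a} → EvArgs Γ [] (base a) a
  more : ∀ {x xs A₁ A a} → (x , A₁) ∈ Γ → EvArgs Γ xs A a → EvArgs Γ (x ∷ xs) (A₁ ⇒ A) a

mutual
  data Can (Sg : Sig) : Ctx → Tm → Ty → Set where
    atm : ∀ {Γ M a} → At Sg Γ M (base a) → Can Sg Γ M (base a)
    lamI : ∀ {Γ x A M B} → x ∉ dom Γ → Can Sg ((x , A) ∷ Γ) M B →
           Can Sg Γ (lam x A M) (A ⇒ B)
    evI : ∀ {Γ i A xs a} → Unique xs → EvArgs Γ xs A a →
          Can Sg Γ (evar i A xs) (base a)

  data At (Sg : Sig) : Ctx → Tm → Ty → Set where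
    conI : ∀ {Γ c A} → cdecl c A ∈ Sg → At Sg Γ (con c) A
    varI : ∀ {Γ x A} → (x , A) ∈ Γ → At Sg Γ (var x) A
    appI : ∀ {Γ M N A B} → At Sg Γ M (A ⇒ B) → Can Sg Γ N A → At Sg Γ (app M N) B

-- labels 1 (strict), 0 (irrelevant), u (unrestricted)
data Lab : Set where
  k1 k0 ku : Lab

data STy : Set where
  sbase : ℕ → STy
  sarr  : Lab → STy → STy → STy

-- sfv i B xs  is  F_B x₁ᵘ … xₙᵘ
data STm : Set where
  scon : ℕ → STm
  svar : ℕ → STm
  slam : ℕ → Lab → STy → STm → STm
  sapp : STm → STm → Lab → STm
  sfv  : ℕ → STy → List ℕ → STm

data SDecl : Set where
  stydecl : ℕ → SDecl
  scdecl  : ℕ → STy → SDecl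

SSig : Set
SSig = List SDecl

SCtx : Set
SCtx = List (ℕ × STy)

data SEvArgs (Γ : SCtx) : List ℕ → STy → ℕ → Set where
  done : ∀ {a} → SEvArgs Γ [] (sbase a) a
  more : ∀ {x xs B₁ B a} → (x , B₁) ∈ Γ → SEvArgs Γ xs B a →
         SEvArgs Γ (x ∷ xs) (sarr ku B₁ B) a

mutual
  -- Γ;Ω;Δ ⊢ M ⇑ A   (Γ unrestricted, Ω irrelevant, Δ strict)
  data SCan (Sg : SSig) : SCtx → SCtx → SCtx → STm → STy → Set where
    atm : ∀ {Γ Ω Δ M a} → SAt Sg Γ Ω Δ M (sbase a) → SCan Sg Γ Ω Δ M (sbase a)
    lamU : ∀ {Γ Ω Δ x A M B} → x ∉ dom (Γ ++ Ω ++ Δ) →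
           SCan Sg ((x , A) ∷ Γ) Ω Δ M B → SCan Sg Γ Ω Δ (slam x ku A M) (sarr ku A B)
    lam0 : ∀ {Γ Ω Δ x A M B} → x ∉ dom (Γ ++ Ω ++ Δ) →
           SCan Sg Γ ((x , A) ∷ Ω) Δ M B → SCan Sg Γ Ω Δ (slam x k0 A M) (sarr k0 A B)
    lam1 : ∀ {Γ Ω Δ x A M B} → x ∉ dom (Γ ++ Ω ++ Δ) →
           SCan Sg Γ Ω ((x , A) ∷ Δ) M B → SCan Sg Γ Ω Δ (slam x k1 A M) (sarr k1 A B)
    evI : ∀ {Γ i B xs a} → Unique xs → SEvArgs Γ xs B a →
          SCan Sg Γ [] [] (sfv i B xs) (sbase a)

  data SAt (Sg : SSig) : SCtx → SCtx → SCtx → STm → STy → Set where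
    conI  : ∀ {Γ Ω c A} → scdecl c A ∈ Sg → SAt Sg Γ Ω [] (scon c) A
    varU  : ∀ {Γ Ω x A} → (x , A) ∈ Γ → SAt Sg Γ Ω [] (svar x) A
    varS  : ∀ {Γ Ω x A} → SAt Sg Γ Ω ((x , A) ∷ []) (svar x) A
    appU  : ∀ {Γ Ω Δ M N A B} → SAt Sg Γ Ω Δ M (sarr ku A B) →
            SCan Sg (Γ ++ Δ) Ω [] N A → SAt Sg Γ Ω Δ (sapp M N ku) B
    app0  : ∀ {Γ Ω Δ M N A B} → SAt Sg Γ Ω Δ M (sarr k0 A B) →
            SCan Sg (Γ ++ Ω ++ Δ) [] [] N A → SAt Sg Γ Ω Δ (sapp M N k0) B
    -- Δ is the (disjoint) union Δ_M , Δ_N, modelled as an interleaving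
    app1  : ∀ {Γ Ω Δ ΔM ΔN M N A B} → Interleaving ΔM ΔN Δ →
            SAt Sg (Γ ++ ΔN) Ω ΔM M (sarr k1 A B) →
            SCan Sg (Γ ++ ΔM) Ω ΔN N A → SAt Sg Γ Ω Δ (sapp M N k1) B

mutual
  _⁺ : Ty → STy
  base a ⁺ = sbase a
  (A ⇒ B) ⁺ = sarr k1 (A ⁻) (B ⁺)

  _⁻ : Ty → STy
  base a ⁻ = sbase a
  (A ⇒ B) ⁻ = sarr ku (A ⁺) (B ⁻)

mutual
  tm⁻ : Tm → STm
  tm⁻ (lam x A M)     = slam x ku (A ⁺) (tm⁻ M)
  tm⁻ (evar i A xs)   = sfv i (A ⁻) xs      -- fresh F_{A⁻} per E_A, indexed by i
  tm⁻ (con c)         = tm⁺ (con c)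
  tm⁻ (var x)         = tm⁺ (var x)
  tm⁻ (app M N)       = tm⁺ (app M N)

  -- M⁺ (for atomic terms; the λ / evar clauses are junk, never used on atomic terms)
  tm⁺ : Tm → STm
  tm⁺ (con c)       = scon c
  tm⁺ (var x)       = svar x
  tm⁺ (app M N)     = sapp (tm⁺ M) (tm⁻ N) k1
  tm⁺ (lam x A M)   = slam x ku (A ⁺) (tm⁻ M)
  tm⁺ (evar i A xs) = sfv i (A ⁻) xs

ctx⁺ : Ctx → SCtx
ctx⁺ [] = []
ctx⁺ ((x , A) ∷ Γ) = (x , A ⁺) ∷ ctx⁺ Γ

sig⁺ : Sig → SSig
sig⁺ [] = []
sig⁺ (tydecl a ∷ Sg) = stydecl a ∷ sig⁺ Sg
sig⁺ (cdecl c A ∷ Sg) = scdecl c (A ⁺) ∷ sig⁺ Sg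

{-# OPTIONS --safe #-}
module Submission where

-- Every hypothesis of Γ⁺ is
-- unrestricted, so the irrelevant and strict contexts stay empty throughout;
-- an application M⁺ (N⁻)¹ is then typed by the strict application rule with
-- the empty strict context split into two empty halves.

open import Defs
open import Data.Product using (_×_; _,_)
open import Data.List using ([]; _∷_; _++_)
open import Data.List.Properties using (++-identityʳ)
open import Data.List.Relation.Unary.Any using (here; there)
open import Data.List.Membership.Propositional using (_∈_; _∉_)
open import Data.List.Relation.Ternary.Interleaving using ([])
open import Relation.Binary.PropositionalEquality using (_≡_; refl; cong; subst; sym)

∈-sig⁺ : ∀ {Sg c A} → cdecl c A ∈ Sg → scdecl c (A ⁺) ∈ sig⁺ Sg
∈-sig⁺ {_ ∷ _}         (here refl) = here refl
∈-sig⁺ {tydecl _ ∷ _}  (there p)   = there (∈-sig⁺ p)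
∈-sig⁺ {cdecl _ _ ∷ _} (there p)   = there (∈-sig⁺ p)

∈-ctx⁺ : ∀ {Γ x A} → (x , A) ∈ Γ → (x , A ⁺) ∈ ctx⁺ Γ
∈-ctx⁺ {_ ∷ _} (here refl) = here refl
∈-ctx⁺ {_ ∷ _} (there p)   = there (∈-ctx⁺ p)

dom-ctx⁺ : ∀ Γ → dom (ctx⁺ Γ) ≡ dom Γ
dom-ctx⁺ []            = refl
dom-ctx⁺ ((x , _) ∷ Γ) = cong (x ∷_) (dom-ctx⁺ Γ)

∉-ctx⁺ : ∀ {Γ x} → x ∉ dom Γ → x ∉ dom (ctx⁺ Γ ++ [] ++ [])
∉-ctx⁺ {Γ} x∉Γ rewrite ++-identityʳ (ctx⁺ Γ) | dom-ctx⁺ Γ = x∉Γ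

evArgs⁻ : ∀ {Γ xs A a} → EvArgs Γ xs A a → SEvArgs (ctx⁺ Γ) xs (A ⁻) a
evArgs⁻ done       = done
evArgs⁻ (more p e) = more (∈-ctx⁺ p) (evArgs⁻ e)

app1-unrestricted : ∀ {Sg Γ Ω M N A B} →
  SAt Sg Γ Ω [] M (sarr k1 A B) → SCan Sg Γ Ω [] N A → SAt Sg Γ Ω [] (sapp M N k1) B
app1-unrestricted {Sg} {Γ} {Ω} {M} {N} {A} {B} m n =
  app1 [] (subst (λ Γ′ → SAt Sg Γ′ Ω [] M (sarr k1 A B)) Γ≡Γ++[] m)
          (subst (λ Γ′ → SCan Sg Γ′ Ω [] N A) Γ≡Γ++[] n)
  where
  Γ≡Γ++[] : Γ ≡ Γ ++ []
  Γ≡Γ++[] = sym (++-identityʳ Γ)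

mutual
  Can⇒SCan : ∀ {Sg Γ M A} → Can Sg Γ M A → SCan (sig⁺ Sg) (ctx⁺ Γ) [] [] (tm⁻ M) (A ⁻)
  Can⇒SCan (atm d@(conI _))   = atm (At⇒SAt d)
  Can⇒SCan (atm d@(varI _))   = atm (At⇒SAt d)
  Can⇒SCan (atm d@(appI _ _)) = atm (At⇒SAt d)
  Can⇒SCan (lamI x∉Γ d)       = lamU (∉-ctx⁺ x∉Γ) (Can⇒SCan d)
  Can⇒SCan (evI xs-unique e)  = evI xs-unique (evArgs⁻ e)

  At⇒SAt : ∀ {Sg Γ M A} → At Sg Γ M A → SAt (sig⁺ Sg) (ctx⁺ Γ) [] [] (tm⁺ M) (A ⁺)
  At⇒SAt (conI p)   = conI (∈-sig⁺ p)
  At⇒SAt (varI p)   = varU (∈-ctx⁺ p)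
  At⇒SAt (appI m n) = app1-unrestricted (At⇒SAt m) (Can⇒SCan n)

theorem5p4 : ∀ {Sg : Sig} {Γ : Ctx} {M : Tm} {A : Ty} →
    (Can Sg Γ M A → SCan (sig⁺ Sg) (ctx⁺ Γ) [] [] (tm⁻ M) (A ⁻)) ×
    (At Sg Γ M A → SAt (sig⁺ Sg) (ctx⁺ Γ) [] [] (tm⁺ M) (A ⁺))
theorem5p4 = Can⇒SCan , At⇒SAt
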